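{- Let $G=(V,E)$ be a graph and $v\in V$. Every minimal zero forcing set of $G$ contains $v$ if and only if $v$ is an isolated vertex of $G$.
   Context: All graphs are finite, simple and undirected. Given a set $S$ of initially blue vertices (all others white), the zero forcing color change rule says that a blue vertex with exactly one white neighbor causes that neighbor to become blue. $S$ is a zero forcing set if repeatedly applying this rule eventually makes every vertex blue; a minimal zero forcing set is a zero forcing set containing no other zero forcing set as a proper subset. -}

module Defs where

open import Data.Nat using (ℕ)
open import Data.Fin using (Fin)
open import Data.Bool using (Bool; true; false)
open import Data.Fin.Subset using (Subset; _∈_; _⊂_)
open import Relation.Binary.PropositionalEquality using (_≡_)
open import Relation.Nullary using (¬_)
open import Data.Product using (_×_)

record Graph (n : ℕ) : Set where
  field
    adj   : Fin n → Fin n → Bool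
    sym   : ∀ u v → adj u v ≡ adj v u
    irrefl : ∀ v → adj v v ≡ false

open Graph public

Adj : ∀ {n} → Graph n → Fin n → Fin n → Set
Adj G u v = adj G u v ≡ true

data Blue {n : ℕ} (G : Graph n) (S : Subset n) : Fin n → Set where
  initial : ∀ {v} → v ∈ S → Blue G S v
  force   : ∀ {u w} → Blue G S u → Adj G u w →
            (∀ x → Adj G u x → ¬ (x ≡ w) → Blue G S x) →
            Blue G S w

ZeroForcingSet : ∀ {n} → Graph n → Subset n → Set
ZeroForcingSet G S = ∀ v → Blue G S v

MinimalZeroForcingSet : ∀ {n} → Graph n → Subset n → Set
MinimalZeroForcingSet G S =
  ZeroForcingSet G S × (∀ T → T ⊂ S → ¬ ZeroForcingSet G T)

Isolated : ∀ {n} → Graph n → Fin n → Set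
Isolated G v = ∀ u → ¬ Adj G v u

-- An isolated vertex can never be forced, so it lies in every zero forcing set.
-- Conversely, if v has a neighbour u then V ∖ {v} is zero forcing (u forces v),
-- and it contains a minimal zero forcing set, which then misses v.
module Submission where

open import Defs
open import Data.Nat using (ℕ)
open import Data.Fin using (Fin; _≟_)
open import Data.Fin.Subset using (Subset; _∈_; _⊆_; _⊂_; ∁; ⁅_⁆)
open import Data.Fin.Subset.Properties
  using (⊆-refl; ⊆-trans; x∈⁅x⁆; x≢y⇒x∉⁅y⁆; x∉p⇒x∈∁p; x∈∁p⇒x∉p)
open import Data.Fin.Subset.Induction using (⊂-wellFounded)
open import Induction.WellFounded using (Acc; acc)
open import Data.Product using (Σ-syntax; _×_; _,_; proj₁)
open import Data.Empty using (⊥-elim)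
open import Relation.Nullary using (¬_; yes; no)
open import Relation.Binary.PropositionalEquality using (_≢_; refl; trans)
  renaming (sym to ≡-sym)

≢⇒∈∁⁅⁆ : ∀ {n} {x v : Fin n} → x ≢ v → x ∈ ∁ ⁅ v ⁆
≢⇒∈∁⁅⁆ x≢v = x∉p⇒x∈∁p (x≢y⇒x∉⁅y⁆ x≢v)

-- Constructively we only get the double negation, which suffices since the
-- goal where it is used is a negation.
¬¬∃minimal⊆ : ∀ {n} (P : Subset n → Set) {S : Subset n} → Acc _⊂_ S → P S →
  ¬ ¬ (Σ[ T ∈ Subset n ] T ⊆ S × P T × (∀ U → U ⊂ T → ¬ P U))
¬¬∃minimal⊆ P {S} (acc rec) pS noMinimal =
  noMinimal (S , ⊆-refl , pS , λ U U⊂S pU →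
    ¬¬∃minimal⊆ P (rec U⊂S) pU λ { (T , T⊆U , minT) →
      noMinimal (T , ⊆-trans T⊆U (proj₁ U⊂S) , minT) })

module _ {n : ℕ} (G : Graph n) where

  Adj-sym : ∀ {u v} → Adj G u v → Adj G v u
  Adj-sym {u} {v} u~v = trans (Graph.sym G v u) u~v

  Adj⇒≢ : ∀ {u v} → Adj G u v → u ≢ v
  Adj⇒≢ {u} u~u refl with () ← trans (≡-sym u~u) (Graph.irrefl G u)

  isolated-blue⇒∈ : ∀ {S v} → Isolated G v → Blue G S v → v ∈ S
  isolated-blue⇒∈ iso (initial v∈S)       = v∈S
  isolated-blue⇒∈ iso (force {u} _ u~v _) = ⊥-elim (iso u (Adj-sym u~v))

  ∁⁅⁆-zeroForcing : ∀ {u v} → Adj G v u → ZeroForcingSet G (∁ ⁅ v ⁆)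
  ∁⁅⁆-zeroForcing {v = v} v~u w with w ≟ v
  ... | no w≢v  = initial (≢⇒∈∁⁅⁆ w≢v)
  ... | yes refl =
    force (initial (≢⇒∈∁⁅⁆ (Adj⇒≢ (Adj-sym v~u)))) (Adj-sym v~u)
          (λ x _ x≢v → initial (≢⇒∈∁⁅⁆ x≢v))

proposition3p8 : ∀ {n : ℕ} (G : Graph n) (v : Fin n) →
    ((∀ (S : Subset n) → MinimalZeroForcingSet G S → v ∈ S) → Isolated G v)
    × (Isolated G v → ∀ (S : Subset n) → MinimalZeroForcingSet G S → v ∈ S)
proposition3p8 G v = in-all-minimal⇒isolated , isolated⇒in-all-minimal
  where
  in-all-minimal⇒isolated : (∀ S → MinimalZeroForcingSet G S → v ∈ S) → Isolated G v
  in-all-minimal⇒isolated inAll u v~u =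
    ¬¬∃minimal⊆ (ZeroForcingSet G) (⊂-wellFounded _) (∁⁅⁆-zeroForcing G v~u)
      λ { (T , T⊆∁⁅v⁆ , minT) → x∈∁p⇒x∉p (T⊆∁⁅v⁆ (inAll T minT)) (x∈⁅x⁆ v) }

  isolated⇒in-all-minimal : Isolated G v → ∀ S → MinimalZeroForcingSet G S → v ∈ S
  isolated⇒in-all-minimal iso S (zfs , _) = isolated-blue⇒∈ G iso (zfs v)
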